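{- If $t$ is a closed infinitary lambda tree of ground type $\iota$, then for every $n\in\mathbb N$, $\vdash^n_\emptyset \{q\in Q\mid \mathfrak A\text{ has a run on }t^\beta\text{ starting in }q\}:t:\iota$.
   Context: Setting: $\Sigma'$ ranked alphabet, $\Sigma=\Sigma'\cup\{\mathcal R,\beta\}$ with $\mathcal R,\beta$ unary; $\mathfrak A$ a fixed trivial automaton over $\Sigma$ (maximal arity $N$) with finite state set $Q$, $\delta\colon Q\times\Sigma\to\mathcal P((Q\cup\{\ast\})^N)$, $\delta(q,\mathfrak f)\subseteq Q^{\mathrm{ar}(\mathfrak f)}\times\{\ast\}^{N-\mathrm{ar}(\mathfrak f)}$. A run starting in $q$ on a $\Sigma$-term labels nodes by states, root by $q$, such that for each $\mathfrak f$-node $p$ with children $p_i$, $(r(p_1),\dots,r(p_{\mathrm{ar}(\mathfrak f)}),\ast,\dots,\ast)\in\delta(r(p),\mathfrak f)$. Lambda trees: possibly infinite simply-typed trees of variables, $\lambda$-abstractions, applications and constants $\mathfrak f\in\Sigma'$ of type $\iota^{\mathrm{ar}(\mathfrak f)}\to\iota$. Continuous normal form $t^\beta=\mathrm{cn}(t;())$ with coinductively $\mathrm{cn}(rs;\vec t)=\mathcal R(\mathrm{cn}(r;s,\vec t))$, $\mathrm{cn}(\lambda x.r;s,\vec t)=\beta(\mathrm{cn}(r[s/x];\vec t))$, $\mathrm{cn}(\mathfrak f;\vec t)=\mathfrak f(t_1^\beta,\dots,t_n^\beta)$. Semantics $\llbracket\iota\rrbracket=\mathcal P(Q)$, $\llbracket\rho\to\sigma\rrbracket$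 all functions, $\sqsubseteq$ inclusion/pointwise; liftings $\mathcal R(f)(\vec a)=\{q\mid\delta(q,\mathcal R)\cap(f\vec a\times\{\ast\}^{N-1})\ne\emptyset\}$, $\beta(f)$ analogously. Contexts: finite maps $x^\sigma\mapsto\llbracket\sigma\rrbracket$, update $\Gamma^a_x$. Proof system $\vdash^n_\Gamma a:t:\rho$ by induction on $n$: (i) $n=0$ always; (ii) variable $x$: $a\sqsubseteq\Gamma(x)$; (iii) $\vdash^{n+1}_\Gamma a:st:\sigma$ if some $f\in\llbracket\rho\to\sigma\rrbracket,u\in\llbracket\rho\rrbracket$ have $a\sqsubseteq\mathcal R(fu)$, $\vdash^n_\Gamma f:s:\rho\to\sigma$, $\vdash^n_\Gamma u:t:\rho$; (iv) $\vdash^{n+1}_\Gamma f:\lambda x^\rho.s:\rho\to\sigma$ if for all $a$ some $b_a$ has $fa\sqsubseteq\beta(b_a)$ and $\vdash^n_{\Gamma^a_x}b_a:s:\sigma$; (v) $\vdash^n_\Gamma f:\mathfrak f$ if for all $\vec a\in\mathcal P(Q)^{\mathrm{ar}(\mathfrak f)}$, $f\vec a\subseteq\{q\mid\delta(q,\mathfrak f)\cap(a_1\times\dots\times a_{\mathrm{ar}(\mathfrak f)}\times\{\ast\}^{N-\mathrm{ar}(\mathfrak f)})\ne\emptyset\}$. -}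

module Defs where

open import Level using (Lift; 0ℓ) renaming (suc to lsuc)
open import Data.Nat using (ℕ; zero; suc; _<_)
import Data.Nat as Nat
open import Data.Fin using (Fin; toℕ)
open import Data.Vec using (Vec; []; _∷_; lookup; tabulate)
open import Data.List using (List; []; _∷_; _++_)
open import Data.List.Membership.Propositional using (_∈_)
open import Data.Maybe using (Maybe; just; nothing)
open import Data.Product using (Σ; ∃; _×_; _,_)
open import Data.Unit using (⊤)
open import Data.Empty using (⊥)
open import Relation.Nullary using (Dec; yes; no)
open import Relation.Binary.PropositionalEquality using (_≡_; refl)

record Alphabet : Set where
  field
    nSym : ℕ
    ar   : Fin nSym → ℕ
  Sym : Set
  Sym = Fin nSym

Path : Set
Path = List ℕ

child : ∀ {L : Set} → (Path → L) → ℕ → (Path → L)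
child t i p = t (i ∷ p)

Pos : ∀ {L : Set} → (L → ℕ) → (Path → L) → Path → Set
Pos arity t []      = ⊤
Pos arity t (i ∷ p) = (i < arity (t [])) × Pos arity (child t i) p

module Alph (A : Alphabet) where
  open Alphabet A

  data Sig : Set where
    sym : Sym → Sig
    𝓡   : Sig
    𝛃   : Sig

  arΣ : Sig → ℕ
  arΣ (sym f) = ar f
  arΣ 𝓡 = 1
  arΣ 𝛃 = 1

  Tree : Set
  Tree = Path → Sig

  PosT : Tree → Path → Set
  PosT = Pos arΣ

data Ty : Set where
  ι   : Ty
  _⇒_ : Ty → Ty → Ty
infixr 20 _⇒_

ground : ℕ → Ty
ground zero    = ι
ground (suc n) = ι ⇒ ground n

_≟Ty_ : (ρ σ : Ty) → Dec (ρ ≡ σ)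
ι ≟Ty ι = yes refl
ι ≟Ty (_ ⇒ _) = no (λ ())
(_ ⇒ _) ≟Ty ι = no (λ ())
(ρ ⇒ σ) ≟Ty (ρ' ⇒ σ') with ρ ≟Ty ρ' | σ ≟Ty σ'
... | yes refl | yes refl = yes refl
... | no ne    | _        = no (λ { refl → ne refl })
... | yes _    | no ne    = no (λ { refl → ne refl })

-- Lambda trees over Σ' (Church style: every node carries its type;
-- variables are x^σ with name x ∈ ℕ and type σ)

module Lam (A : Alphabet) where
  open Alphabet A
  open Alph A

  data Node : Set where
    var : ℕ → Ty → Node
    app : Ty → Ty → Node             -- application, arg type ρ, result σ  (children 0: fun, 1: arg)
    lam : ℕ → Ty → Ty → Node         -- λx^ρ. _ of type ρ → σ   (child 0: body)
    con : Sym → Node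

  arN : Node → ℕ
  arN (var _ _)   = 0
  arN (app _ _)   = 2
  arN (lam _ _ _) = 1
  arN (con _)     = 0

  tyN : Node → Ty
  tyN (var x σ)   = σ
  tyN (app ρ σ)   = σ
  tyN (lam x ρ σ) = ρ ⇒ σ
  tyN (con f)     = ground (ar f)

  LTree : Set
  LTree = Path → Node

  PosL : LTree → Path → Set
  PosL = Pos arN

  LocalTyped : LTree → Set
  LocalTyped t with t []
  ... | var _ _   = ⊤
  ... | con _     = ⊤
  ... | app ρ σ   = (tyN (t (0 ∷ [])) ≡ (ρ ⇒ σ)) × (tyN (t (1 ∷ [])) ≡ ρ)
  ... | lam x ρ σ = tyN (t (0 ∷ [])) ≡ σ

  subtree : LTree → Path → LTree
  subtree t p q = t (p ++ q)

  WellTyped : LTree → Set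
  WellTyped t = ∀ p → PosL t p → LocalTyped (subtree t p)

  boundAlong : LTree → Path → List (ℕ × Ty)
  boundAlong t []      = []
  boundAlong t (i ∷ p) with t []
  ... | lam x ρ σ = (x , ρ) ∷ boundAlong (child t i) p
  ... | _         = boundAlong (child t i) p

  Closed : LTree → Set
  Closed t = ∀ p x σ → PosL t p → t p ≡ var x σ → (x , σ) ∈ boundAlong t p

  ClosedOfType : LTree → Ty → Set
  ClosedOfType t σ = WellTyped t × Closed t × (tyN (t []) ≡ σ)

  -- substitution r[s/x^ρ] of a closed tree s (no capture possible)
  sameVar : ℕ → Ty → ℕ → Ty → Set
  sameVar x ρ y τ = (x ≡ y) × (ρ ≡ τ)

  sameVar? : ∀ x ρ y τ → Dec (sameVar x ρ y τ)
  sameVar? x ρ y τ with x Nat.≟ y | ρ ≟Ty τ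
  ... | yes e | yes e' = yes (e , e')
  ... | no ne | _      = no (λ { (e , _) → ne e })
  ... | yes _ | no ne  = no (λ { (_ , e') → ne e' })

  substL : ℕ → Ty → LTree → LTree → LTree
  substL x ρ s r p with r []
  substL x ρ s r p | var y τ with sameVar? x ρ y τ
  ... | yes _ = s p
  ... | no _  = r p
  substL x ρ s r [] | lam y τ σ = lam y τ σ
  substL x ρ s r (i ∷ p) | lam y τ σ with sameVar? x ρ y τ
  ... | yes _ = r (i ∷ p)
  ... | no _  = substL x ρ s (child r i) p
  substL x ρ s r [] | app ρ' σ = app ρ' σ
  substL x ρ s r (i ∷ p) | app ρ' σ = substL x ρ s (child r i) p
  substL x ρ s r p | con f = con f

  lookupL : List LTree → ℕ → Maybe LTree
  lookupL []       _       = nothing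
  lookupL (t ∷ ts) zero    = just t
  lookupL (t ∷ ts) (suc i) = lookupL ts i

  -- continuous normal form cn(t; t⃗), computed node by node.
  -- Cases that cannot occur for closed well-typed trees with matching
  -- stacks ('junk') are given the arbitrary label 𝓡.
  cn : LTree → List LTree → Tree
  cn t st []      with t []
  ... | app _ _   = 𝓡
  ... | lam _ _ _ = 𝛃
  ... | con f     = sym f
  ... | var _ _   = 𝓡
  cn t st (i ∷ p) with t []
  ... | app _ _   = cn (child t 0) (child t 1 ∷ st) p
  cn t []       (i ∷ p) | lam x ρ σ = 𝓡
  cn t (s ∷ st) (i ∷ p) | lam x ρ σ = cn (substL x ρ s (child t 0)) st p
  cn t st (i ∷ p) | con f with lookupL st i
  ... | just tᵢ  = cn tᵢ [] p
  ... | nothing  = 𝓡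
  cn t st (i ∷ p) | var _ _ = 𝓡

  _^β : LTree → Tree
  t ^β = cn t []

-- Trivial automata over Σ with finite state set Q = Fin nQ.
-- δ(q, g) is given directly as a set of arΣ(g)-tuples of states
-- (the ∗-padding to length N in the paper is pure encoding).

record Automaton (A : Alphabet) : Set₁ where
  open Alph A
  field
    nQ : ℕ
  Q : Set
  Q = Fin nQ
  field
    δ : Q → (g : Sig) → Vec Q (arΣ g) → Set

module Sem (A : Alphabet) (𝔄 : Automaton A) where
  open Alphabet A
  open Alph A
  open Lam A
  open Automaton 𝔄

  Run : Q → Tree → Set
  Run q T = Σ (Path → Q) λ r → (r [] ≡ q) ×
            (∀ p → PosT T p → δ (r p) (T p) (tabulate λ (i : Fin (arΣ (T p))) → r (p ++ (toℕ i ∷ []))))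

  runSet : Tree → Q → Set
  runSet T q = Run q T

  ⟦_⟧ : Ty → Set₁
  ⟦ ι ⟧     = Q → Set
  ⟦ ρ ⇒ σ ⟧ = ⟦ ρ ⟧ → ⟦ σ ⟧

  _⊑_ : ∀ {σ} → ⟦ σ ⟧ → ⟦ σ ⟧ → Set₁
  _⊑_ {ι}     a b = Lift (lsuc 0ℓ) (∀ q → a q → b q)
  _⊑_ {ρ ⇒ σ} f g = ∀ x → f x ⊑ g x

  -- liftings ℛ(f) and β(f):  g(f)(a⃗) = {q | δ(q,g) ∩ (f a⃗ × {∗}^{N-1}) ≠ ∅}
  data Unary : Sig → Set where
    u𝓡 : Unary 𝓡
    u𝛃 : Unary 𝛃

  single : ∀ {g} → Unary g → Q → Vec Q (arΣ g)
  single u𝓡 q = q ∷ []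
  single u𝛃 q = q ∷ []

  liftU : ∀ {g} → Unary g → ∀ σ → ⟦ σ ⟧ → ⟦ σ ⟧
  liftU {g} u ι a q = ∃ λ q' → a q' × δ q g (single u q')
  liftU u (ρ ⇒ σ) f x = liftU u σ (f x)

  ℛ⟦_⟧ : ∀ {σ} → ⟦ σ ⟧ → ⟦ σ ⟧
  ℛ⟦_⟧ {σ} = liftU u𝓡 σ

  β⟦_⟧ : ∀ {σ} → ⟦ σ ⟧ → ⟦ σ ⟧
  β⟦_⟧ {σ} = liftU u𝛃 σ

  Cx : Set₁
  Cx = (x : ℕ) (σ : Ty) → Maybe ⟦ σ ⟧

  ∅ : Cx
  ∅ _ _ = nothing

  update : Cx → (x : ℕ) (ρ : Ty) → ⟦ ρ ⟧ → Cx
  update Γ x ρ a y σ with x Nat.≟ y | ρ ≟Ty σ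
  ... | yes _ | yes refl = just a
  ... | _     | _        = Γ y σ

  applyN : ∀ n → ⟦ ground n ⟧ → Vec (Q → Set) n → Q → Set
  applyN zero    a []       = a
  applyN (suc n) f (a ∷ as) = applyN n (f a) as

  data Der (Γ : Cx) : ℕ → (σ : Ty) → ⟦ σ ⟧ → LTree → Set₁
  syntax Der Γ n σ a t = Γ ⊢[ n ] a ∶ t ∶ σ
  data Der Γ where
    r-zero : ∀ {σ a t} → Γ ⊢[ 0 ] a ∶ t ∶ σ
    r-var  : ∀ {n σ a t x} → t [] ≡ var x σ →
             (Σ ⟦ σ ⟧ λ b → (Γ x σ ≡ just b) × (a ⊑ b)) →
             Γ ⊢[ n ] a ∶ t ∶ σ
    r-app  : ∀ {n ρ σ a t} → t [] ≡ app ρ σ →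
             (f : ⟦ ρ ⇒ σ ⟧) (u : ⟦ ρ ⟧) → a ⊑ ℛ⟦ f u ⟧ →
             Γ ⊢[ n ] f ∶ child t 0 ∶ (ρ ⇒ σ) → Γ ⊢[ n ] u ∶ child t 1 ∶ ρ →
             Γ ⊢[ suc n ] a ∶ t ∶ σ
    r-lam  : ∀ {n x ρ σ f t} → t [] ≡ lam x ρ σ →
             (∀ (a : ⟦ ρ ⟧) → Σ ⟦ σ ⟧ λ b → (f a ⊑ β⟦ b ⟧) × (update Γ x ρ a ⊢[ n ] b ∶ child t 0 ∶ σ)) →
             Γ ⊢[ suc n ] f ∶ t ∶ (ρ ⇒ σ)
    r-con  : ∀ {n 𝔣 f t} → t [] ≡ con 𝔣 →
             (∀ (as : Vec (Q → Set) (ar 𝔣)) (q : Q) → applyN (ar 𝔣) f as q →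
                ∃ λ (qs : Vec Q (ar 𝔣)) → δ q (sym 𝔣) qs × (∀ i → lookup as i (lookup qs i))) →
             Γ ⊢[ n ] f ∶ t ∶ ground (ar 𝔣)

-- For each depth n read a value canon n Γ σ r off the tree, taking every side
-- condition of the rules (ii)–(v) as an equality and top at depth 0; it is
-- derivable by construction. What remains is that every state with a run on
-- t^β lies in canon n ∅ ι t. This is a logical relation along the continuous
-- normal form: a value is Sound for a continuation K (normal forms of the head
-- under argument stacks) if at ground type it contains every state with a run on
-- K [], and at arrow type it sends Robust arguments to Sound results. Robustness
-- asks for soundness after any further substitutions, because substituted
-- arguments are not known to be closed; with it, the invariant Instance (T is r
-- with robust terms substituted for the variables of Γ) survives the
-- substitutions that cn performs under binders.
module Submission where

open import Defs
open import Data.Nat using (ℕ; zero; suc; _<_; z≤n; s≤s)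
import Data.Nat as Nat
open import Data.Fin using (Fin; toℕ; zero; suc)
open import Data.Fin.Properties using (toℕ<n)
open import Data.Vec using (Vec; []; _∷_; lookup; tabulate; toList)
open import Data.Vec.Properties using (lookup∘tabulate)
open import Level using (Lift; lift; lower)
open import Data.Maybe.Properties using (just-injective)
open import Data.Maybe using (Maybe; just; nothing)
open import Data.List using (List; []; _∷_; _++_; foldr; filter)
open import Data.List.Properties using (foldr-++; ++-assoc; filter-++; filter-accept)
open import Data.List.Relation.Binary.Pointwise as Pointwise using (Pointwise; []; _∷_)
open import Data.List.Relation.Unary.All using (All; []; _∷_)
open import Data.List.Relation.Unary.All.Properties using (++⁺; all-filter; filter⁺)
open import Data.List.Relation.Unary.Any using (here; there)
open import Data.List.Membership.Propositional using (_∈_)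
import Data.Maybe.Relation.Binary.Pointwise as Maybe
open import Data.Product using (Σ; ∃; _×_; _,_; proj₁; proj₂)
open import Data.Unit using (⊤; tt)
open import Data.Sum using (_⊎_; inj₁; inj₂)
open import Data.Empty using (⊥; ⊥-elim)
open import Function using (_∘_)
open import Relation.Nullary using (yes; no; ¬_; ¬?)
open import Relation.Unary using (Decidable)
open import Relation.Binary.PropositionalEquality
  using (_≡_; _≗_; refl; trans; cong; cong-app; subst)
import Relation.Binary.PropositionalEquality as ≡
open ≡.≡-Reasoning

module Substitution (A : Alphabet) where
  open Alph A
  open Lam A

  NonVar : Node → Set
  NonVar (var _ _) = ⊥
  NonVar _         = ⊤

  module _ (x : ℕ) (ρ : Ty) (s : LTree) where

    substL-root : ∀ r {nd} → r [] ≡ nd → NonVar nd → substL x ρ s r [] ≡ nd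
    substL-root r {lam _ _ _} eq _ rewrite eq = refl
    substL-root r {app _ _}   eq _ rewrite eq = refl
    substL-root r {con _}     eq _ rewrite eq = refl

    substL-var-hit : ∀ r {y τ} → r [] ≡ var y τ → sameVar x ρ y τ → substL x ρ s r ≗ s
    substL-var-hit r {y} {τ} eq hit p rewrite eq with sameVar? x ρ y τ
    ... | yes _   = refl
    ... | no miss = ⊥-elim (miss hit)

    substL-var-miss : ∀ r {y τ} → r [] ≡ var y τ → ¬ sameVar x ρ y τ → substL x ρ s r ≗ r
    substL-var-miss r {y} {τ} eq miss p rewrite eq with sameVar? x ρ y τ
    ... | yes hit = ⊥-elim (miss hit)
    ... | no _    = refl

    substL-app-child : ∀ r {ρ' σ} i → r [] ≡ app ρ' σ →
                       child (substL x ρ s r) i ≗ substL x ρ s (child r i)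
    substL-app-child r i eq p rewrite eq = refl

    substL-lam-shadowed : ∀ r {y τ σ} i → r [] ≡ lam y τ σ → sameVar x ρ y τ →
                          child (substL x ρ s r) i ≗ child r i
    substL-lam-shadowed r {y} {τ} i eq hit p rewrite eq with sameVar? x ρ y τ
    ... | yes _   = refl
    ... | no miss = ⊥-elim (miss hit)

    substL-lam-child : ∀ r {y τ σ} i → r [] ≡ lam y τ σ → ¬ sameVar x ρ y τ →
                       child (substL x ρ s r) i ≗ substL x ρ s (child r i)
    substL-lam-child r {y} {τ} i eq miss p rewrite eq with sameVar? x ρ y τ
    ... | yes hit = ⊥-elim (miss hit)
    ... | no _    = refl

  substL-cong : ∀ x ρ {s s'} r r' → s ≗ s' → r ≗ r' → substL x ρ s r ≗ substL x ρ s' r'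
  substL-cong x ρ r r' s≗s' r≗r' p with r [] | r' [] | r≗r' []
  ... | var y τ | _ | refl with sameVar? x ρ y τ
  ...   | yes _ = s≗s' p
  ...   | no _  = r≗r' p
  substL-cong x ρ r r' s≗s' r≗r' [] | lam _ _ _ | _ | refl = refl
  substL-cong x ρ r r' s≗s' r≗r' (i ∷ p) | lam y τ _ | _ | refl with sameVar? x ρ y τ
  ... | yes _ = r≗r' (i ∷ p)
  ... | no _  = substL-cong x ρ (child r i) (child r' i) s≗s' (r≗r' ∘ (i ∷_)) p
  substL-cong x ρ r r' s≗s' r≗r' [] | app _ _ | _ | refl = refl
  substL-cong x ρ r r' s≗s' r≗r' (i ∷ p) | app _ _ | _ | refl =
    substL-cong x ρ (child r i) (child r' i) s≗s' (r≗r' ∘ (i ∷_)) p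
  substL-cong x ρ r r' s≗s' r≗r' p | con _ | _ | refl = refl

  Binding : Set
  Binding = ℕ × Ty × LTree

  substBinding : Binding → LTree → LTree
  substBinding (x , ρ , s) = substL x ρ s

  -- The head of the list is substituted last.
  substAll : List Binding → LTree → LTree
  substAll l T = foldr substBinding T l

  substAll-++ : ∀ l m T → substAll (l ++ m) T ≡ substAll l (substAll m T)
  substAll-++ l m T = foldr-++ substBinding T l m

  substAll-cong : ∀ l {T T'} → T ≗ T' → substAll l T ≗ substAll l T'
  substAll-cong []                T≗T' = T≗T'
  substAll-cong ((x , ρ , s) ∷ l) T≗T' =
    substL-cong x ρ (substAll l _) (substAll l _) (λ _ → refl) (substAll-cong l T≗T')

  substAll-root : ∀ l T {nd} → T [] ≡ nd → NonVar nd → substAll l T [] ≡ nd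
  substAll-root []                T eq nv = eq
  substAll-root ((x , ρ , s) ∷ l) T eq nv = substL-root x ρ s (substAll l T) (substAll-root l T eq nv) nv

  substAll-app-child : ∀ l T {ρ σ} i → T [] ≡ app ρ σ →
                       child (substAll l T) i ≗ substAll l (child T i)
  substAll-app-child []                T i eq p = refl
  substAll-app-child ((x , ρ , s) ∷ l) T i eq p =
    trans (substL-app-child x ρ s (substAll l T) i (substAll-root l T eq _) p)
          (substL-cong x ρ _ _ (λ _ → refl) (substAll-app-child l T i eq) p)

  BindsOther : ℕ → Ty → Binding → Set
  BindsOther y τ (x , ρ , _) = ¬ sameVar x ρ y τ

  bindsOther? : ∀ y τ → Decidable (BindsOther y τ)
  bindsOther? y τ (x , ρ , _) = ¬? (sameVar? x ρ y τ)

  Unbound : ℕ → Ty → List Binding → Set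
  Unbound y τ = All (BindsOther y τ)

  dropVar : ℕ → Ty → List Binding → List Binding
  dropVar y τ = filter (bindsOther? y τ)

  substAll-lam-child : ∀ l T {x ρ σ} i → T [] ≡ lam x ρ σ →
                       child (substAll l T) i ≗ substAll (dropVar x ρ l) (child T i)
  substAll-lam-child []                T i eq p = refl
  substAll-lam-child ((y , τ , s) ∷ l) T {x} {ρ} i eq p with sameVar? y τ x ρ
  ... | yes hit = trans (substL-lam-shadowed y τ s (substAll l T) i (substAll-root l T eq _) hit p)
                        (substAll-lam-child l T i eq p)
  ... | no miss = trans (substL-lam-child y τ s (substAll l T) i (substAll-root l T eq _) miss p)
                        (substL-cong y τ _ _ (λ _ → refl) (substAll-lam-child l T i eq) p)

  substAll-unbound : ∀ l T {y τ} → T [] ≡ var y τ → Unbound y τ l → substAll l T ≗ T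
  substAll-unbound []                T eq []            p = refl
  substAll-unbound ((x , ρ , s) ∷ l) T eq (miss ∷ un) p =
    trans (substL-var-miss x ρ s (substAll l T) (trans (substAll-unbound l T eq un []) eq) miss p)
          (substAll-unbound l T eq un p)

  lookupL-cong : ∀ {st st'} → Pointwise _≗_ st st' → ∀ i →
                 Maybe.Pointwise _≗_ (lookupL st i) (lookupL st' i)
  lookupL-cong []            i       = Maybe.nothing
  lookupL-cong (s≗s' ∷ st≗)  zero    = Maybe.just s≗s'
  lookupL-cong (s≗s' ∷ st≗)  (suc i) = lookupL-cong st≗ i

  cn-cong : ∀ T T' {st st'} → T ≗ T' → Pointwise _≗_ st st' → cn T st ≗ cn T' st'
  cn-cong T T' T≗T' st≗ [] with T [] | T' [] | T≗T' []
  ... | var _ _   | _ | refl = refl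
  ... | app _ _   | _ | refl = refl
  ... | lam _ _ _ | _ | refl = refl
  ... | con _     | _ | refl = refl
  cn-cong T T' T≗T' st≗ (i ∷ p) with T [] | T' [] | T≗T' []
  ... | var _ _   | _ | refl = refl
  ... | app _ _   | _ | refl =
    cn-cong (child T 0) (child T' 0) (T≗T' ∘ (0 ∷_)) ((T≗T' ∘ (1 ∷_)) ∷ st≗) p
  cn-cong T T' T≗T' []              (i ∷ p) | lam _ _ _ | _ | refl = refl
  cn-cong T T' T≗T' (s≗s' ∷ st≗)    (i ∷ p) | lam x ρ _ | _ | refl =
    cn-cong _ _ (substL-cong x ρ (child T 0) (child T' 0) s≗s' (T≗T' ∘ (0 ∷_))) st≗ p
  cn-cong T T' {st} {st'} T≗T' st≗ (i ∷ p) | con _ | _ | refl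
    with lookupL st i | lookupL st' i | lookupL-cong st≗ i
  ... | just u  | just u' | Maybe.just u≗u' = cn-cong u u' u≗u' [] p
  ... | nothing | nothing | Maybe.nothing   = refl

  cn-app-root : ∀ T {st ρ σ} → T [] ≡ app ρ σ → cn T st [] ≡ 𝓡
  cn-app-root T eq rewrite eq = refl

  cn-app-child : ∀ T {st ρ σ} i → T [] ≡ app ρ σ →
                 child (cn T st) i ≗ cn (child T 0) (child T 1 ∷ st)
  cn-app-child T i eq p rewrite eq = refl

  cn-lam-root : ∀ T {st x ρ σ} → T [] ≡ lam x ρ σ → cn T st [] ≡ 𝛃
  cn-lam-root T eq rewrite eq = refl

  cn-lam-child : ∀ T {s st x ρ σ} i → T [] ≡ lam x ρ σ →
                 child (cn T (s ∷ st)) i ≗ cn (substL x ρ s (child T 0)) st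
  cn-lam-child T i eq p rewrite eq = refl

  cn-con-root : ∀ T {st 𝔣} → T [] ≡ con 𝔣 → cn T st [] ≡ sym 𝔣
  cn-con-root T eq rewrite eq = refl

  cn-con-child : ∀ T {st 𝔣 u} i → T [] ≡ con 𝔣 → lookupL st i ≡ just u →
                 child (cn T st) i ≗ cn u []
  cn-con-child T {st} i eq st[i] p rewrite eq | st[i] = refl

module Semantics (A : Alphabet) (𝔄 : Automaton A) where
  open Alphabet A
  open Alph A
  open Lam A
  open Automaton 𝔄
  open Sem A 𝔄
  open Substitution A

  Pos-cong : ∀ {L : Set} (arity : L → ℕ) {X Y : Path → L} → X ≗ Y →
             ∀ p → Pos arity X p → Pos arity Y p
  Pos-cong arity X≗Y []      _           = tt
  Pos-cong arity X≗Y (i ∷ p) (i<ar , pos) =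
    subst (λ g → i < arity g) (X≗Y []) i<ar , Pos-cong arity (X≗Y ∘ (i ∷_)) p pos

  Transition : (Path → Q) → Path → Sig → Set
  Transition r p g = δ (r p) g (tabulate λ (i : Fin (arΣ g)) → r (p ++ toℕ i ∷ []))

  Run-cong : ∀ {q} X Y → X ≗ Y → Run q X → Run q Y
  Run-cong X Y X≗Y (r , r[]≡q , ok) =
    r , r[]≡q , λ p pos → subst (Transition r p) (X≗Y p) (ok p (Pos-cong arΣ (≡.sym ∘ X≗Y) p pos))

  Run-root : ∀ {q} X {g} (R : Run q X) → X [] ≡ g →
             δ q g (tabulate λ (i : Fin (arΣ g)) → proj₁ R (toℕ i ∷ []))
  Run-root X (r , refl , ok) refl = ok [] tt

  Run-child : ∀ {q} X Y i (R : Run q X) → i < arΣ (X []) → child X i ≗ Y → Run (proj₁ R (i ∷ [])) Y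
  Run-child X Y i (r , _ , ok) i<ar X≗Y =
    (λ p → r (i ∷ p)) , refl ,
    λ p pos → subst (Transition (λ p → r (i ∷ p)) p) (X≗Y p)
                    (ok (i ∷ p) (i<ar , Pos-cong arΣ (≡.sym ∘ X≗Y) p pos))

  top : ∀ σ → ⟦ σ ⟧
  top ι       = λ _ → ⊤
  top (ρ ⇒ σ) = λ _ → top σ

  ⊑-refl : ∀ σ (a : ⟦ σ ⟧) → a ⊑ a
  ⊑-refl ι       a = lift (λ _ h → h)
  ⊑-refl (ρ ⇒ σ) f = λ x → ⊑-refl σ (f x)

  orTop : ∀ σ → Maybe ⟦ σ ⟧ → ⟦ σ ⟧
  orTop σ (just b) = b
  orTop σ nothing  = top σ

  -- The bound that rule (v) puts on the value of 𝔣.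
  preCon : (𝔣 : Sym) → Vec (Q → Set) (ar 𝔣) → Q → Set
  preCon 𝔣 as q = ∃ λ (qs : Vec Q (ar 𝔣)) → δ q (sym 𝔣) qs × (∀ i → lookup as i (lookup qs i))

  -- Junk value top when σ is not ι^m → ι.
  curryAt : (σ : Ty) (m : ℕ) → (Vec (Q → Set) m → Q → Set) → ⟦ σ ⟧
  curryAt ι             zero    P = P []
  curryAt ι             (suc m) P = top ι
  curryAt (ρ ⇒ σ)       zero    P = top (ρ ⇒ σ)
  curryAt (ι ⇒ σ)       (suc m) P = λ a → curryAt σ m (λ as → P (a ∷ as))
  curryAt ((ρ ⇒ ρ') ⇒ σ) (suc m) P = top ((ρ ⇒ ρ') ⇒ σ)

  ⊑-curryAt-ground : ∀ m (P : Vec (Q → Set) m → Q → Set) a → a ⊑ curryAt (ground m) m P →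
                     ∀ as q → applyN m a as q → P as q
  ⊑-curryAt-ground zero    P a a⊑ []       = lower a⊑
  ⊑-curryAt-ground (suc m) P f f⊑ (a ∷ as) = ⊑-curryAt-ground m (λ as → P (a ∷ as)) (f a) (f⊑ a) as

  -- Junk value top on a variable or λ whose type disagrees with σ.
  canon : ℕ → Cx → (σ : Ty) → LTree → ⟦ σ ⟧
  canonAt : ℕ → Cx → (σ : Ty) → Node → LTree → ⟦ σ ⟧
  canon zero    Γ σ r = top σ
  canon (suc n) Γ σ r = canonAt n Γ σ (r []) r
  canonAt n Γ σ (var y τ) r with τ ≟Ty σ
  ... | yes _ = orTop σ (Γ y σ)
  ... | no _  = top σ
  canonAt n Γ σ (app ρ _) r = ℛ⟦ canon n Γ (ρ ⇒ σ) (child r 0) (canon n Γ ρ (child r 1)) ⟧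
  canonAt n Γ ι (lam _ _ _) r = top ι
  canonAt n Γ (ρ' ⇒ σ) (lam x ρ _) r with ρ ≟Ty ρ'
  ... | yes refl = λ a → β⟦ canon n (update Γ x ρ a) σ (child r 0) ⟧
  ... | no _     = top (ρ' ⇒ σ)
  canonAt n Γ σ (con 𝔣) r = curryAt σ (ar 𝔣) (preCon 𝔣)

  Defined : Cx → ℕ → (τ : Ty) → Set₁
  Defined Γ x τ = Σ ⟦ τ ⟧ λ b → Γ x τ ≡ just b

  update-self : ∀ Γ x ρ (a : ⟦ ρ ⟧) → update Γ x ρ a x ρ ≡ just a
  update-self Γ x ρ a with x Nat.≟ x | ρ ≟Ty ρ
  ... | yes _   | yes refl = refl
  ... | no x≢x  | _        = ⊥-elim (x≢x refl)
  ... | yes _   | no ρ≢ρ   = ⊥-elim (ρ≢ρ refl)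

  update-Defined : ∀ Γ x ρ (a : ⟦ ρ ⟧) {y τ} → Defined Γ y τ → Defined (update Γ x ρ a) y τ
  update-Defined Γ x ρ a {y} {τ} Γy with x Nat.≟ y | ρ ≟Ty τ
  ... | yes _ | yes refl = a , refl
  ... | yes _ | no _     = Γy
  ... | no _  | _        = Γy

  WellScoped : Cx → LTree → Set₁
  WellScoped Γ r =
    ∀ p x τ → PosL r p → r p ≡ var x τ → (x , τ) ∈ boundAlong r p ⊎ Defined Γ x τ

  WellTyped-child : ∀ r {nd} i → r [] ≡ nd → i < arN nd → WellTyped r → WellTyped (child r i)
  WellTyped-child r i refl i<ar wt p pos = wt (i ∷ p) (i<ar , pos)

  LocalTyped-app : ∀ r {ρ σ} → r [] ≡ app ρ σ → LocalTyped r →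
                   (tyN (r (0 ∷ [])) ≡ ρ ⇒ σ) × (tyN (r (1 ∷ [])) ≡ ρ)
  LocalTyped-app r eq rewrite eq = λ lt → lt

  LocalTyped-lam : ∀ r {x ρ σ} → r [] ≡ lam x ρ σ → LocalTyped r → tyN (r (0 ∷ [])) ≡ σ
  LocalTyped-lam r eq rewrite eq = λ lt → lt

  boundAlong-app : ∀ r {ρ σ} i p → r [] ≡ app ρ σ → boundAlong r (i ∷ p) ≡ boundAlong (child r i) p
  boundAlong-app r i p eq rewrite eq = refl

  boundAlong-lam : ∀ r {x ρ σ} i p → r [] ≡ lam x ρ σ →
                   boundAlong r (i ∷ p) ≡ (x , ρ) ∷ boundAlong (child r i) p
  boundAlong-lam r i p eq rewrite eq = refl

  WellScoped-app-child : ∀ r {Γ ρ σ} i → r [] ≡ app ρ σ → i < 2 →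
                         WellScoped Γ r → WellScoped Γ (child r i)
  WellScoped-app-child r {Γ} i eq i<2 sc p x τ pos r≡ =
    subst (λ bound → (x , τ) ∈ bound ⊎ Defined Γ x τ) (boundAlong-app r i p eq)
          (sc (i ∷ p) x τ (subst (λ nd → i < arN nd) (≡.sym eq) i<2 , pos) r≡)

  WellScoped-lam-body : ∀ r {Γ x ρ σ} (a : ⟦ ρ ⟧) → r [] ≡ lam x ρ σ → WellScoped Γ r →
                        WellScoped (update Γ x ρ a) (child r 0)
  WellScoped-lam-body r {Γ} {x} {ρ} a eq sc p y τ pos r≡
    with subst (λ bound → (y , τ) ∈ bound ⊎ Defined Γ y τ) (boundAlong-lam r 0 p eq)
               (sc (0 ∷ p) y τ (subst (λ nd → 0 < arN nd) (≡.sym eq) (s≤s z≤n) , pos) r≡)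
  ... | inj₁ (here refl) = inj₂ (a , update-self Γ x ρ a)
  ... | inj₁ (there y∈)  = inj₁ y∈
  ... | inj₂ Γy          = inj₂ (update-Defined Γ x ρ a Γy)

  canon-derivable : ∀ n Γ σ r {a} → WellTyped r → WellScoped Γ r → tyN (r []) ≡ σ →
                    a ⊑ canon n Γ σ r → Γ ⊢[ n ] a ∶ r ∶ σ
  canon-derivable zero    Γ σ r wt sc ty a⊑ = r-zero
  canon-derivable (suc n) Γ σ r {a} wt sc ty a⊑ with r [] in eq
  ... | var x τ with refl ← ty | τ ≟Ty τ | sc [] x τ tt eq
  ...   | no τ≢τ   | _               = ⊥-elim (τ≢τ refl)
  ...   | yes refl | inj₂ (b , Γx≡b) = r-var eq (b , Γx≡b , subst (a ⊑_) (cong (orTop τ) Γx≡b) a⊑)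
  canon-derivable (suc n) Γ σ r wt sc ty a⊑ | app ρ σ' with refl ← ty =
    r-app eq _ _ a⊑
      (canon-derivable n Γ (ρ ⇒ σ') (child r 0) (WellTyped-child r 0 eq (s≤s z≤n) wt)
         (WellScoped-app-child r 0 eq (s≤s z≤n) sc) (proj₁ (LocalTyped-app r eq (wt [] tt))) (⊑-refl _ _))
      (canon-derivable n Γ ρ (child r 1) (WellTyped-child r 1 eq (s≤s (s≤s z≤n)) wt)
         (WellScoped-app-child r 1 eq (s≤s (s≤s z≤n)) sc) (proj₂ (LocalTyped-app r eq (wt [] tt)))
         (⊑-refl _ _))
  canon-derivable (suc n) Γ σ r wt sc ty f⊑ | lam x ρ σ' with refl ← ty | ρ ≟Ty ρ
  ... | no ρ≢ρ   = ⊥-elim (ρ≢ρ refl)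
  ... | yes refl = r-lam eq λ a →
    canon n (update Γ x ρ a) σ' (child r 0) , f⊑ a ,
    canon-derivable n (update Γ x ρ a) σ' (child r 0) (WellTyped-child r 0 eq (s≤s z≤n) wt)
      (WellScoped-lam-body r a eq sc) (LocalTyped-lam r eq (wt [] tt)) (⊑-refl _ _)
  canon-derivable (suc n) Γ σ r wt sc ty f⊑ | con 𝔣 with refl ← ty =
    r-con eq (⊑-curryAt-ground (ar 𝔣) (preCon 𝔣) _ f⊑)

  -- K st is the continuous normal form of the head term applied to the stack st.
  Continuation : Set
  Continuation = List LTree → Tree

  Sound : ∀ σ → Continuation → ⟦ σ ⟧ → Set₁
  Robust : ∀ σ → LTree → ⟦ σ ⟧ → Set₁
  Sound ι       K a = _⊑_ {ι} (runSet (K [])) a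
  Sound (ρ ⇒ σ) K f = ∀ u b → Robust ρ u b → Sound σ (K ∘ (u ∷_)) (f b)
  Robust σ u b = ∀ l → Sound σ (cn (substAll l u)) b

  Sound-cong : ∀ σ {K K' a} → (∀ st → K st ≗ K' st) → Sound σ K a → Sound σ K' a
  Sound-cong ι       {K} {K'} K≗K' (lift sound) =
    lift λ q R → sound q (Run-cong (K' []) (K []) (≡.sym ∘ K≗K' []) R)
  Sound-cong (ρ ⇒ σ) K≗K' sound u b robust = Sound-cong σ (K≗K' ∘ (u ∷_)) (sound u b robust)

  Sound-top : ∀ σ K → Sound σ K (top σ)
  Sound-top ι       K = lift λ _ _ → tt
  Sound-top (ρ ⇒ σ) K = λ u b _ → Sound-top σ (K ∘ (u ∷_))

  unary-arity : ∀ {g} → Unary g → 0 < arΣ g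
  unary-arity u𝓡 = s≤s z≤n
  unary-arity u𝛃 = s≤s z≤n

  Run-root-unary : ∀ {g q} X (un : Unary g) (R : Run q X) → X [] ≡ g →
                   δ q g (single un (proj₁ R (0 ∷ [])))
  Run-root-unary X u𝓡 R eq = Run-root X R eq
  Run-root-unary X u𝛃 R eq = Run-root X R eq

  Sound-lift : ∀ {g} (un : Unary g) σ {K K' a} →
               (∀ st → K st [] ≡ g) → (∀ st → child (K st) 0 ≗ K' st) →
               Sound σ K' a → Sound σ K (liftU un σ a)
  Sound-lift un ι {K} {K'} root child≗ (lift sound) = lift λ q R →
    proj₁ R (0 ∷ []) ,
    sound _ (Run-child (K []) (K' []) 0 R (subst (λ g → 0 < arΣ g) (≡.sym (root [])) (unary-arity un))
                       (child≗ [])) ,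
    Run-root-unary (K []) un R (root [])
  Sound-lift un (ρ ⇒ σ) root child≗ sound u b robust =
    Sound-lift un σ (root ∘ (u ∷_)) (child≗ ∘ (u ∷_)) (sound u b robust)

  lookupL-toList : ∀ {m} (us : Vec LTree m) i → lookupL (toList us) (toℕ i) ≡ just (lookup us i)
  lookupL-toList (u ∷ us) zero    = refl
  lookupL-toList (u ∷ us) (suc i) = lookupL-toList us i

  Sound-curryAt : ∀ σ m K (P : Vec (Q → Set) m → Q → Set) →
    (∀ (us : Vec LTree m) as → (∀ i → Robust ι (lookup us i) (lookup as i)) →
       ∀ q → Run q (K (toList us)) → P as q) →
    Sound σ K (curryAt σ m P)
  Sound-curryAt ι              zero    K P sound = lift (sound [] [] (λ ()))
  Sound-curryAt ι              (suc m) K P sound = Sound-top ι K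
  Sound-curryAt (ρ ⇒ σ)        zero    K P sound = Sound-top (ρ ⇒ σ) K
  Sound-curryAt (ι ⇒ σ)        (suc m) K P sound u b robust =
    Sound-curryAt σ m (K ∘ (u ∷_)) (λ as → P (b ∷ as))
      (λ us as robusts → sound (u ∷ us) (b ∷ as) λ { zero → robust ; (suc i) → robusts i })
  Sound-curryAt ((ρ ⇒ ρ') ⇒ σ) (suc m) K P sound = Sound-top ((ρ ⇒ ρ') ⇒ σ) K

  Run-con-preCon : ∀ T {𝔣} → T [] ≡ con 𝔣 →
                   ∀ (us : Vec LTree (ar 𝔣)) as → (∀ i → Robust ι (lookup us i) (lookup as i)) →
                   ∀ q → Run q (cn T (toList us)) → preCon 𝔣 as q
  Run-con-preCon T {𝔣} eq us as robusts q R =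
    tabulate childState , Run-root (cn T (toList us)) R (cn-con-root T {toList us} eq) , λ i →
      subst (lookup as i) (≡.sym (lookup∘tabulate childState i))
        (lower (robusts i []) (childState i)
          (Run-child (cn T (toList us)) (cn (lookup us i) []) (toℕ i) R
            (subst (λ g → toℕ i < arΣ g) (≡.sym (cn-con-root T {toList us} eq)) (toℕ<n i))
            (cn-con-child T (toℕ i) eq (lookupL-toList us i))))
    where
      childState : Fin (ar 𝔣) → Q
      childState i = proj₁ R (toℕ i ∷ [])

  -- T arises from r by substituting, for each variable y^σ bound in Γ to b, a
  -- term robust for b; further substitutions are kept in view under binders.
  Instance : ℕ → Cx → (σ : Ty) → LTree → LTree → Set₁
  InstanceAt : ℕ → Cx → (σ : Ty) → Node → LTree → LTree → Set₁
  Instance zero    Γ σ r T = Lift _ ⊤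
  Instance (suc n) Γ σ r T = InstanceAt n Γ σ (r []) r T
  InstanceAt n Γ σ (var y τ) r T with τ ≟Ty σ | Γ y σ
  ... | yes _ | just b = Σ (List Binding) λ l → Σ LTree λ s → Robust σ s b × (T ≗ substAll l s)
  ... | _     | _      = Lift _ ⊤
  InstanceAt n Γ σ (app ρ σ') r T =
    (T [] ≡ app ρ σ') ×
    Instance n Γ (ρ ⇒ σ) (child r 0) (child T 0) × Instance n Γ ρ (child r 1) (child T 1)
  InstanceAt n Γ ι (lam _ _ _) r T = Lift _ ⊤
  InstanceAt n Γ (ρ' ⇒ σ) (lam x ρ σ') r T with ρ ≟Ty ρ'
  ... | yes refl = (T [] ≡ lam x ρ σ') ×
        (∀ l → Unbound x ρ l → ∀ s b → Robust ρ s b →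
           Instance n (update Γ x ρ b) σ (child r 0) (substL x ρ s (substAll l (child T 0))))
  ... | no _ = Lift _ ⊤
  InstanceAt n Γ σ (con 𝔣) r T = Lift _ (T [] ≡ con 𝔣)

  Instance-cong : ∀ n Γ σ r {T T'} → T ≗ T' → Instance n Γ σ r T → Instance n Γ σ r T'
  Instance-cong zero    Γ σ r T≗T' I = I
  Instance-cong (suc n) Γ σ r T≗T' I with r []
  ... | var y τ with τ ≟Ty σ | Γ y σ
  ...   | yes _ | just b = let (l , s , robust , T≗) = I in
          l , s , robust , λ p → trans (≡.sym (T≗T' p)) (T≗ p)
  ...   | yes _ | nothing = I
  ...   | no _  | _       = I
  Instance-cong (suc n) Γ σ r T≗T' (root , I₀ , I₁) | app ρ σ' =
    trans (≡.sym (T≗T' [])) root ,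
    Instance-cong n Γ (ρ ⇒ σ) (child r 0) (T≗T' ∘ (0 ∷_)) I₀ ,
    Instance-cong n Γ ρ (child r 1) (T≗T' ∘ (1 ∷_)) I₁
  Instance-cong (suc n) Γ ι r T≗T' I | lam x ρ σ' = I
  Instance-cong (suc n) Γ (ρ' ⇒ σ) r {T} {T'} T≗T' I | lam x ρ σ' with ρ ≟Ty ρ'
  ... | yes refl = let (root , body) = I in
    trans (≡.sym (T≗T' [])) root ,
    λ l unbound s b robust → Instance-cong n (update Γ x ρ b) σ (child r 0)
      (substL-cong x ρ _ _ (λ _ → refl) (substAll-cong l (T≗T' ∘ (0 ∷_)))) (body l unbound s b robust)
  ... | no _ = I
  Instance-cong (suc n) Γ σ r T≗T' (lift root) | con 𝔣 = lift (trans (≡.sym (T≗T' [])) root)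

  Instance-substAll : ∀ n Γ σ r T l → Instance n Γ σ r T → Instance n Γ σ r (substAll l T)
  Instance-substAll zero    Γ σ r T l I = I
  Instance-substAll (suc n) Γ σ r T l I with r []
  ... | var y τ with τ ≟Ty σ | Γ y σ
  ...   | yes _ | just b = let (m , s , robust , T≗) = I in
          l ++ m , s , robust , λ p → trans (substAll-cong l T≗ p) (cong-app (≡.sym (substAll-++ l m s)) p)
  ...   | yes _ | nothing = I
  ...   | no _  | _       = I
  Instance-substAll (suc n) Γ σ r T l (root , I₀ , I₁) | app ρ σ' =
    substAll-root l T root _ ,
    Instance-cong n Γ (ρ ⇒ σ) (child r 0) (≡.sym ∘ substAll-app-child l T 0 root)
      (Instance-substAll n Γ (ρ ⇒ σ) (child r 0) (child T 0) l I₀) ,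
    Instance-cong n Γ ρ (child r 1) (≡.sym ∘ substAll-app-child l T 1 root)
      (Instance-substAll n Γ ρ (child r 1) (child T 1) l I₁)
  Instance-substAll (suc n) Γ ι r T l I | lam x ρ σ' = I
  Instance-substAll (suc n) Γ (ρ' ⇒ σ) r T l I | lam x ρ σ' with ρ ≟Ty ρ'
  ... | yes refl = let (root , body) = I in
    substAll-root l T root _ ,
    λ l' unbound s b robust → Instance-cong n (update Γ x ρ b) σ (child r 0)
      (substL-cong x ρ _ _ (λ _ → refl) λ p →
        trans (cong-app (substAll-++ l' (dropVar x ρ l) (child T 0)) p)
              (substAll-cong l' (≡.sym ∘ substAll-lam-child l T 0 root) p))
      (body (l' ++ dropVar x ρ l) (++⁺ unbound (all-filter (bindsOther? x ρ) l)) s b robust)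
  ... | no _ = I
  Instance-substAll (suc n) Γ σ r T l (lift root) | con 𝔣 = lift (substAll-root l T root _)

  canon-sound : ∀ n Γ σ r T → Instance n Γ σ r T → Sound σ (cn T) (canon n Γ σ r)
  canon-sound zero    Γ σ r T I = Sound-top σ (cn T)
  canon-sound (suc n) Γ σ r T I with r []
  ... | var y τ with τ ≟Ty σ
  ...   | no _ = Sound-top σ (cn T)
  ...   | yes _ with Γ y σ
  ...     | nothing = Sound-top σ (cn T)
  ...     | just b  = let (l , s , robust , T≗) = I in
            Sound-cong σ (λ st → cn-cong (substAll l s) T (≡.sym ∘ T≗) (Pointwise.refl (λ _ → refl)))
              (robust l)
  canon-sound (suc n) Γ σ r T (root , I₀ , I₁) | app ρ σ' =
    Sound-lift u𝓡 σ (λ st → cn-app-root T {st} root) (λ st → cn-app-child T 0 root)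
      (canon-sound n Γ (ρ ⇒ σ) (child r 0) (child T 0) I₀ (child T 1) (canon n Γ ρ (child r 1))
        λ l → canon-sound n Γ ρ (child r 1) (substAll l (child T 1))
                (Instance-substAll n Γ ρ (child r 1) (child T 1) l I₁))
  canon-sound (suc n) Γ ι r T I | lam x ρ σ' = Sound-top ι (cn T)
  canon-sound (suc n) Γ (ρ' ⇒ σ) r T I | lam x ρ σ' with ρ ≟Ty ρ'
  ... | yes refl = let (root , body) = I in λ u b robust →
    Sound-lift u𝛃 σ (λ st → cn-lam-root T {u ∷ st} root) (λ st → cn-lam-child T 0 root)
      (canon-sound n (update Γ x ρ b) σ (child r 0) (substL x ρ u (child T 0)) (body [] [] u b robust))
  ... | no _ = Sound-top (ρ' ⇒ σ) (cn T)
  canon-sound (suc n) Γ σ r T (lift root) | con 𝔣 =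
    Sound-curryAt σ (ar 𝔣) (cn T) (preCon 𝔣) (Run-con-preCon T root)

  LastBinding : List Binding → (y : ℕ) (σ : Ty) → ⟦ σ ⟧ → Set₁
  LastBinding χ y σ b = Σ (List Binding) λ l₁ → Σ LTree λ s → Σ (List Binding) λ l₂ →
    (χ ≡ l₁ ++ (y , σ , s) ∷ l₂) × Unbound y σ l₂ × Robust σ s b

  Realized : Cx → List Binding → Set₁
  Realized Γ χ = ∀ y σ b → Γ y σ ≡ just b → LastBinding χ y σ b

  Realized-∅ : Realized ∅ []
  Realized-∅ _ _ _ ()

  LastBinding-extend : ∀ {χ y σ b} x ρ s l → ¬ sameVar y σ x ρ → LastBinding χ y σ b →
                       LastBinding ((x , ρ , s) ∷ l ++ dropVar x ρ χ) y σ b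
  LastBinding-extend {y = y} {σ} x ρ s l miss (l₁ , s' , l₂ , refl , unbound , robust) =
    (x , ρ , s) ∷ l ++ dropVar x ρ l₁ , s' , dropVar x ρ l₂ , cong ((x , ρ , s) ∷_) (begin
      l ++ dropVar x ρ (l₁ ++ (y , σ , s') ∷ l₂)
        ≡⟨ cong (l ++_) (filter-++ (bindsOther? x ρ) l₁ _) ⟩
      l ++ dropVar x ρ l₁ ++ dropVar x ρ ((y , σ , s') ∷ l₂)
        ≡⟨ cong (λ m → l ++ dropVar x ρ l₁ ++ m) (filter-accept (bindsOther? x ρ) miss) ⟩
      l ++ dropVar x ρ l₁ ++ (y , σ , s') ∷ dropVar x ρ l₂
        ≡⟨ ≡.sym (++-assoc l (dropVar x ρ l₁) _) ⟩
      (l ++ dropVar x ρ l₁) ++ (y , σ , s') ∷ dropVar x ρ l₂ ∎) ,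
    filter⁺ (bindsOther? x ρ) unbound , robust

  Realized-update : ∀ {Γ χ x ρ l s b} → Realized Γ χ → Unbound x ρ l → Robust ρ s b →
                    Realized (update Γ x ρ b) ((x , ρ , s) ∷ l ++ dropVar x ρ χ)
  Realized-update {Γ} {χ} {x} {ρ} {l} {s} realized unbound robust y σ b' Γy≡ with x Nat.≟ y | ρ ≟Ty σ
  ... | yes refl | yes refl =
    [] , s , l ++ dropVar x ρ χ , refl , ++⁺ unbound (all-filter (bindsOther? x ρ) χ) ,
    subst (Robust ρ s) (just-injective Γy≡) robust
  ... | yes refl | no ρ≢σ =
    LastBinding-extend x ρ s l (λ (_ , σ≡ρ) → ρ≢σ (≡.sym σ≡ρ)) (realized y σ b' Γy≡)
  ... | no x≢y   | _      =
    LastBinding-extend x ρ s l (λ (y≡x , _) → x≢y (≡.sym y≡x)) (realized y σ b' Γy≡)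

  substAll-last-binding : ∀ l₁ l₂ r {y σ s} → r [] ≡ var y σ → Unbound y σ l₂ →
                          substAll (l₁ ++ (y , σ , s) ∷ l₂) r ≗ substAll l₁ s
  substAll-last-binding l₁ l₂ r {y} {σ} {s} eq unbound p = begin
    substAll (l₁ ++ (y , σ , s) ∷ l₂) r p
      ≡⟨ cong-app (substAll-++ l₁ _ r) p ⟩
    substAll l₁ (substL y σ s (substAll l₂ r)) p
      ≡⟨ substAll-cong l₁ (substL-var-hit y σ s (substAll l₂ r) l₂r[]≡ (refl , refl)) p ⟩
    substAll l₁ s p
      ∎
    where
      l₂r[]≡ : substAll l₂ r [] ≡ var y σ
      l₂r[]≡ = trans (substAll-unbound l₂ r eq unbound []) eq

  Realized-Instance : ∀ n Γ σ r χ T → Realized Γ χ → T ≗ substAll χ r → Instance n Γ σ r T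
  Realized-Instance zero    Γ σ r χ T realized T≗ = lift tt
  Realized-Instance (suc n) Γ σ r χ T realized T≗ with r [] in eq
  ... | var y τ with τ ≟Ty σ | Γ y σ in Γy≡
  ...   | yes refl | just b = let (l₁ , s , l₂ , χ≡ , unbound , robust) = realized y τ b Γy≡ in
          l₁ , s , robust ,
          λ p → trans (T≗ p) (trans (cong (λ c → substAll c r p) χ≡)
                                    (substAll-last-binding l₁ l₂ r eq unbound p))
  ...   | yes refl | nothing = lift tt
  ...   | no _     | _       = lift tt
  Realized-Instance (suc n) Γ σ r χ T realized T≗ | app ρ σ' =
    trans (T≗ []) (substAll-root χ r eq _) ,
    Realized-Instance n Γ (ρ ⇒ σ) (child r 0) χ (child T 0) realized
      (λ p → trans (T≗ (0 ∷ p)) (substAll-app-child χ r 0 eq p)) ,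
    Realized-Instance n Γ ρ (child r 1) χ (child T 1) realized
      (λ p → trans (T≗ (1 ∷ p)) (substAll-app-child χ r 1 eq p))
  Realized-Instance (suc n) Γ ι r χ T realized T≗ | lam x ρ σ' = lift tt
  Realized-Instance (suc n) Γ (ρ' ⇒ σ) r χ T realized T≗ | lam x ρ σ' with ρ ≟Ty ρ'
  ... | yes refl =
    trans (T≗ []) (substAll-root χ r eq _) ,
    λ l unbound s b robust →
      Realized-Instance n (update Γ x ρ b) σ (child r 0) ((x , ρ , s) ∷ l ++ dropVar x ρ χ) _
        (Realized-update realized unbound robust)
        (substL-cong x ρ _ _ (λ _ → refl) λ p →
          trans (substAll-cong l (λ q → trans (T≗ (0 ∷ q)) (substAll-lam-child χ r 0 eq q)) p)
                (cong-app (≡.sym (substAll-++ l (dropVar x ρ χ) (child r 0))) p))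
  ... | no _ = lift tt
  Realized-Instance (suc n) Γ σ r χ T realized T≗ | con 𝔣 =
    lift (trans (T≗ []) (substAll-root χ r eq _))

  runSet-⊑-canon : ∀ n t → runSet (t ^β) ⊑ canon n ∅ ι t
  runSet-⊑-canon n t = canon-sound n ∅ ι t t (Realized-Instance n ∅ ι t [] t Realized-∅ (λ _ → refl))

corollary8p10 : (A : Alphabet) (𝔄 : Automaton A) (t : Lam.LTree A) →
    Lam.ClosedOfType A t ι → (n : ℕ) →
    Sem.Der A 𝔄 (Sem.∅ A 𝔄) n ι (Sem.runSet A 𝔄 (Lam._^β A t)) t
corollary8p10 A 𝔄 t (wellTyped , closed , t∶ι) n =
  canon-derivable n ∅ ι t wellTyped (λ p x τ pos t[p] → inj₁ (closed p x τ pos t[p])) t∶ι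
    (runSet-⊑-canon n t)
  where
    open Sem A 𝔄 using (∅)
    open Semantics A 𝔄
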